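{- For every positive integer $m$, $$A_{2m+1}^+(s,t)=(s+t)A_{2m}^+(s,t)+st\,D A_{2m}^+(s,t),\qquad A_{2m+1}^-(s,t)=(s+t)A_{2m}^-(s,t)+st\,D A_{2m}^-(s,t),$$ where $D=\frac{\partial}{\partial s}+\frac{\partial}{\partial t}$.
   Context: For a permutation $\pi=\pi_1\cdots\pi_n$ of $[n]$ let $\mathsf{des}(\pi)=|\{i\in[n-1]:\pi_i>\pi_{i+1}\}|$ and $\mathsf{asc}(\pi)=n-1-\mathsf{des}(\pi)$. Let $\mathfrak{S}_n$ be the symmetric group and $\mathcal{A}_n$ the alternating group. $A_n^+(s,t)=\sum_{\pi\in\mathcal{A}_n}t^{\mathsf{des}(\pi)}s^{\mathsf{asc}(\pi)}$ and $A_n^-(s,t)=\sum_{\pi\in\mathfrak{S}_n\setminus\mathcal{A}_n}t^{\mathsf{des}(\pi)}s^{\mathsf{asc}(\pi)}$. -}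

module Defs where

open import Data.Nat using (ℕ; zero; suc; _+_; _*_; _∸_; _%_; _<?_; _≟_)
open import Data.Fin using (Fin; toℕ)
open import Data.Fin.Properties using () renaming (_≟_ to _≟ᶠ_)
open import Data.List using (List; []; _∷_; [_]; map; concatMap; filter; length; allFin)
import Data.List.Relation.Unary.Unique.DecPropositional as UniqueDec
open import Relation.Nullary using (¬?; yes; no)
open import Relation.Nullary.Decidable using (_×-dec_)
open import Relation.Binary.PropositionalEquality using (_≡_)

-- Permutations of [n] in one-line notation π₁⋯πₙ (entries in Fin n,
-- i.e. the values 0,…,n-1 standing for 1,…,n).

words : (k n : ℕ) → List (List (Fin n))
words zero    n = [ [] ]
words (suc k) n = concatMap (λ w → map (_∷ w) (allFin n)) (words k n)

perms : (n : ℕ) → List (List (Fin n))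
perms n = filter (UniqueDec.unique? (_≟ᶠ_ {n})) (words n n)

des : {n : ℕ} → List (Fin n) → ℕ
des []          = 0
des (x ∷ [])    = 0
des (x ∷ y ∷ r) = descentAt x y + des (y ∷ r)
  where
  descentAt : {n : ℕ} → Fin n → Fin n → ℕ
  descentAt a b with toℕ b <? toℕ a
  ... | yes _ = 1
  ... | no  _ = 0

asc : {n : ℕ} → List (Fin n) → ℕ
asc {n} π = (n ∸ 1) ∸ des π

inv : {n : ℕ} → List (Fin n) → ℕ
inv []      = 0
inv (x ∷ r) = length (filter (λ y → toℕ y <? toℕ x) r) + inv r

-- π ∈ 𝒜ₙ iff π is an even permutation iff inv(π) is even
-- Bivariate polynomials in s,t with ℕ coefficients, represented by their
-- coefficient function: P i j = coefficient of s^i t^j.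

Poly : Set
Poly = ℕ → ℕ → ℕ

_≐_ : Poly → Poly → Set
P ≐ Q = ∀ i j → P i j ≡ Q i j

infix 4 _≐_
infixl 6 _⊕_

_⊕_ : Poly → Poly → Poly
(P ⊕ Q) i j = P i j + Q i j

s· : Poly → Poly
s· P zero    j = 0
s· P (suc i) j = P i j

t· : Poly → Poly
t· P i zero    = 0
t· P i (suc j) = P i j

∂s : Poly → Poly
∂s P i j = suc i * P (suc i) j

∂t : Poly → Poly
∂t P i j = suc j * P i (suc j)

D : Poly → Poly
D P = ∂s P ⊕ ∂t P

A⁺ : ℕ → Poly
A⁺ n i j = length (filter (λ π → (inv π % 2 ≟ 0) ×-dec ((asc π ≟ i) ×-dec (des π ≟ j))) (perms n))

A⁻ : ℕ → Poly
A⁻ n i j = length (filter (λ π → ¬? (inv π % 2 ≟ 0) ×-dec ((asc π ≟ i) ×-dec (des π ≟ j))) (perms n))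

-- Every σ ∈ 𝔖ₙ₊₁ arises exactly once by inserting the maximum into one of the n + 1 slots of
-- some π ∈ 𝔖ₙ. As for the classical Eulerian recurrence, the slots of π produce asc π + 1
-- permutations with statistics (asc π , des π + 1) and des π + 1 with (asc π + 1 , des π), which
-- is the coefficientwise form of (s + t) A + st D A. The signs are the difficulty: the slot with
-- k entries to its left adds n − k inversions, so for n even σ has the parity of π only when k
-- is even. When k is odd, σ = A ++ max ∷ B with |A| and |B| odd; its partner B ++ max ∷ A has
-- the same descents and comes from the rotation B ++ A of π, whose parity is flipped because
-- exchanging two blocks changes the number of inversions by |A|·|B|. Summing over this
-- involution, every insertion can be counted with the parity of π instead of that of σ.

module Submission where

open import Defs
open import Data.Bool using (Bool; true; false; not; _∧_; T)
open import Data.Bool.Properties using (∧-zeroʳ)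
open import Data.Empty using (⊥-elim)
open import Data.Fin using (Fin; toℕ; fromℕ; inject₁; lower₁)
open import Data.Fin.Properties using (toℕ-inject₁; toℕ-fromℕ; toℕ<n; toℕ-injective; inject₁-injective; fromℕ≢inject₁; inject₁-lower₁) renaming (_≟_ to _≟ᶠ_)
open import Data.List using (List; []; _∷_; _++_; map; concatMap; filter; length; allFin; take; drop; cartesianProduct; upTo; applyUpTo)
open import Data.List.Properties using (map-++; map-∘; map-applyUpTo; length-map; length-++; length-take; length-drop; take++drop≡id; take-map; drop-map; ∷-injective; map-injective; length-tabulate)
open import Data.List.Membership.Propositional using (_∈_; _∉_; find)
open import Data.List.Membership.Propositional.Properties using (∈-map⁺; ∈-map⁻; ∈-++⁻; ∈-++⁺ˡ; ∈-++⁺ʳ; ∈-∃++; ∈-concatMap⁺; ∈-concatMap⁻; ∈-filter⁺; ∈-filter⁻; ∈-allFin; ∈-cartesianProduct⁺; ∈-cartesianProduct⁻; ∈-upTo⁺; ∈-upTo⁻)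
open import Data.List.Membership.Propositional.Properties.WithK using (unique∧set⇒bag)
import Data.List.Membership.DecPropositional as DecMembership
open import Data.List.Relation.Unary.Any using (here; there)
import Data.List.Relation.Unary.Any as Any
open import Data.List.Relation.Unary.All using (All; []; _∷_)
import Data.List.Relation.Unary.All as All
open import Data.List.Relation.Unary.All.Properties using (All¬⇒¬Any; map⁺; ++⁻ˡ; ++⁻ʳ)
open import Data.List.Relation.Unary.AllPairs using ([]; _∷_)
open import Data.List.Relation.Unary.Unique.Propositional using (Unique)
import Data.List.Relation.Unary.Unique.Propositional.Properties as Unique
import Data.List.Relation.Unary.Unique.DecPropositional as UniqueDec
open import Data.List.Relation.Binary.BagAndSetEquality using (∼bag⇒↭)
open import Data.List.Relation.Binary.Permutation.Propositional using (_↭_; ↭-sym; ↭⇒↭ₛ)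
import Data.List.Relation.Binary.Permutation.Propositional.Properties as ↭
open import Data.List.Relation.Binary.Permutation.Setoid.Properties using (Unique-resp-↭)
open import Data.Nat using (ℕ; zero; suc; pred; _+_; _*_; _∸_; _≤_; _<_; _<?_; _≡ᵇ_; _%_; _≟_; z≤n; s≤s; s≤s⁻¹; parity)
open import Data.Nat.Properties using (+-assoc; +-comm; +-suc; +-identityʳ; *-zeroʳ; *-identityʳ; *-distribˡ-+; <-cmp; <⇒≯; <-irrefl; suc-injective; ≤-trans; ≤-reflexive; m≤m+n; m∸n≤m; m≤n⇒m⊓n≡m; m∸n+n≡m; m+n∸n≡m; m∸[m∸n]≡n; ≡ᵇ⇒≡; module ≤-Reasoning)
open import Data.Nat.Properties using (+-commutativeSemigroup)
open import Algebra.Properties.CommutativeSemigroup +-commutativeSemigroup using () renaming (interchange to +-interchange; x∙yz≈y∙xz to x+[y+z]≡y+[x+z])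
open import Data.Nat.ListAction using (sum)
open import Data.Nat.ListAction.Properties using (sum-++; sum-↭)
open import Data.Nat.Solver using (module +-*-Solver)
open import Data.Parity using (Parity; 0ℙ; 1ℙ)
import Data.Parity as ℙ
import Data.Parity.Properties as ℙ
open import Data.Product using (_×_; _,_; proj₁; proj₂; Σ)
open import Data.Sum using (inj₁; inj₂)
open import Function using (_∘_; id)
open import Function.Bundles using (mk⇔)
open import Relation.Binary using (tri<; tri≈; tri>)
open import Relation.Binary.PropositionalEquality
open import Relation.Nullary using (Dec; does; yes; no; ¬_)
open import Relation.Nullary.Decidable using (dec-true; dec-false)

private variable
  A B : Set
  n : ℕ

𝟙 : Bool → ℕ
𝟙 true  = 1
𝟙 false = 0

∑ : List A → (A → ℕ) → ℕ
∑ xs f = sum (map f xs)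

syntax ∑ xs (λ x → e) = ∑[ x ∈ xs ] e

∑-++ : (xs ys : List A) (f : A → ℕ) → ∑ (xs ++ ys) f ≡ ∑ xs f + ∑ ys f
∑-++ xs ys f = trans (cong sum (map-++ f xs ys)) (sum-++ (map f xs) (map f ys))

∑-map : (g : A → B) (xs : List A) (f : B → ℕ) → ∑ (map g xs) f ≡ ∑ xs (f ∘ g)
∑-map g xs f = cong sum (sym (map-∘ xs))

∑-cong : (xs : List A) {f g : A → ℕ} → (∀ {x} → x ∈ xs → f x ≡ g x) → ∑ xs f ≡ ∑ xs g
∑-cong []       f≗g = refl
∑-cong (x ∷ xs) f≗g = cong₂ _+_ (f≗g (here refl)) (∑-cong xs (f≗g ∘ there))

∑-+ : (xs : List A) (f g : A → ℕ) → ∑[ x ∈ xs ] (f x + g x) ≡ ∑ xs f + ∑ xs g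
∑-+ []       f g = refl
∑-+ (x ∷ xs) f g = trans (cong (f x + g x +_) (∑-+ xs f g)) (+-interchange (f x) (g x) _ _)

∑-*ˡ : (xs : List A) (c : ℕ) (f : A → ℕ) → ∑[ x ∈ xs ] (c * f x) ≡ c * ∑ xs f
∑-*ˡ []       c f = sym (*-zeroʳ c)
∑-*ˡ (x ∷ xs) c f = trans (cong (c * f x +_) (∑-*ˡ xs c f)) (sym (*-distribˡ-+ c (f x) _))

∑-const : (xs : List A) (c : ℕ) → ∑[ _ ∈ xs ] c ≡ length xs * c
∑-const []       c = refl
∑-const (x ∷ xs) c = cong (c +_) (∑-const xs c)

∑-zero : (xs : List A) {f : A → ℕ} → (∀ {x} → x ∈ xs → f x ≡ 0) → ∑ xs f ≡ 0
∑-zero []       f≡0 = refl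
∑-zero (x ∷ xs) f≡0 = cong₂ _+_ (f≡0 (here refl)) (∑-zero xs (f≡0 ∘ there))

∑-comm : (xs : List A) (ys : List B) (f : A → B → ℕ) →
         ∑[ x ∈ xs ] ∑[ y ∈ ys ] f x y ≡ ∑[ y ∈ ys ] ∑[ x ∈ xs ] f x y
∑-comm []       ys f = sym (trans (∑-const ys 0) (*-zeroʳ (length ys)))
∑-comm (x ∷ xs) ys f =
  trans (cong (∑ ys (f x) +_) (∑-comm xs ys f)) (sym (∑-+ ys (f x) _))

∑-cartesianProduct : (xs : List A) (ys : List B) (f : A × B → ℕ) →
                     ∑ (cartesianProduct xs ys) f ≡ ∑[ x ∈ xs ] ∑[ y ∈ ys ] f (x , y)
∑-cartesianProduct []       ys f = refl
∑-cartesianProduct (x ∷ xs) ys f = begin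
  ∑ (map (x ,_) ys ++ cartesianProduct xs ys) f
    ≡⟨ ∑-++ (map (x ,_) ys) _ f ⟩
  ∑ (map (x ,_) ys) f + ∑ (cartesianProduct xs ys) f
    ≡⟨ cong₂ _+_ (∑-map (x ,_) ys f) (∑-cartesianProduct xs ys f) ⟩
  ∑[ y ∈ ys ] f (x , y) + ∑[ x′ ∈ xs ] ∑[ y ∈ ys ] f (x′ , y) ∎
  where open ≡-Reasoning

∑-upTo-suc : (n : ℕ) (f : ℕ → ℕ) → ∑ (upTo (suc n)) f ≡ f 0 + ∑[ k ∈ upTo n ] f (suc k)
∑-upTo-suc n f = cong (f 0 +_) (begin
  ∑ (applyUpTo suc n) f         ≡⟨ cong (λ xs → ∑ xs f) (sym (map-applyUpTo id suc n)) ⟩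
  ∑ (map suc (upTo n)) f        ≡⟨ ∑-map suc (upTo n) f ⟩
  ∑[ k ∈ upTo n ] f (suc k)     ∎)
  where open ≡-Reasoning

length-filter : {P : A → Set} (P? : ∀ x → Dec (P x)) (xs : List A) →
                length (filter P? xs) ≡ ∑[ x ∈ xs ] 𝟙 (does (P? x))
length-filter P? []       = refl
length-filter P? (x ∷ xs) with P? x
... | yes _ = cong suc (length-filter P? xs)
... | no  _ = length-filter P? xs

∑-↭ : {xs ys : List A} → xs ↭ ys → (f : A → ℕ) → ∑ xs f ≡ ∑ ys f
∑-↭ xs↭ys f = sum-↭ (↭.map⁺ f xs↭ys)

-- unlike Unique.map⁺, injectivity is only required on xs
Unique-map : (g : A → B) {xs : List A} → Unique xs →
             (∀ {x y} → x ∈ xs → y ∈ xs → g x ≡ g y → x ≡ y) → Unique (map g xs)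
Unique-map g {[]}     []           inj = []
Unique-map g {x ∷ xs} (x∉xs ∷ xs!) inj =
  map⁺ (All.tabulate λ y∈xs gx≡gy → All.lookup x∉xs y∈xs (inj (here refl) (there y∈xs) gx≡gy))
  ∷ Unique-map g xs! (λ x∈ y∈ → inj (there x∈) (there y∈))

∑-bijection : (g : A → B) {xs : List A} {ys : List B} → Unique xs → Unique ys →
              (∀ {x y} → x ∈ xs → y ∈ xs → g x ≡ g y → x ≡ y) →
              (∀ {x} → x ∈ xs → g x ∈ ys) →
              (∀ {y} → y ∈ ys → Σ A λ x → x ∈ xs × y ≡ g x) →
              (f : B → ℕ) → ∑ ys f ≡ ∑ xs (f ∘ g)
∑-bijection g {xs} {ys} xs! ys! inj into onto f =
  trans (∑-↭ (↭-sym g[xs]↭ys) f) (∑-map g xs f)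
  where
  to : ∀ {z} → z ∈ map g xs → z ∈ ys
  to z∈ with ∈-map⁻ g z∈
  ... | x , x∈ , refl = into x∈
  from : ∀ {z} → z ∈ ys → z ∈ map g xs
  from z∈ with onto z∈
  ... | x , x∈ , refl = ∈-map⁺ g x∈
  g[xs]↭ys : map g xs ↭ ys
  g[xs]↭ys = ∼bag⇒↭ (unique∧set⇒bag (Unique-map g xs! inj) ys! (mk⇔ to from))

∑-involution : (τ : A → A) {xs : List A} → Unique xs →
               (∀ {x} → x ∈ xs → τ x ∈ xs) → (∀ {x} → x ∈ xs → τ (τ x) ≡ x) →
               (f : A → ℕ) → ∑ xs f ≡ ∑ xs (f ∘ τ)
∑-involution τ xs! into invol = ∑-bijection τ xs! xs!
  (λ x∈ y∈ τx≡τy → trans (sym (invol x∈)) (trans (cong τ τx≡τy) (invol y∈)))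
  into (λ y∈ → τ _ , into y∈ , sym (invol y∈))

x+y≡z⇒y≡x+z : ∀ p {q r : Parity} → p ℙ.+ q ≡ r → q ≡ p ℙ.+ r
x+y≡z⇒y≡x+z 0ℙ      refl = refl
x+y≡z⇒y≡x+z 1ℙ {0ℙ} refl = refl
x+y≡z⇒y≡x+z 1ℙ {1ℙ} refl = refl

parity-∸ : ∀ {n k} → parity n ≡ 0ℙ → k ≤ n → parity (n ∸ k) ≡ parity k
parity-∸ {n} {k} n-even k≤n = trans (x+y≡z⇒y≡x+z (parity k) (begin
  parity k ℙ.+ parity (n ∸ k) ≡⟨ ℙ.+-comm (parity k) _ ⟩
  parity (n ∸ k) ℙ.+ parity k ≡⟨ sym (ℙ.+-homo-+ (n ∸ k) k) ⟩
  parity (n ∸ k + k)          ≡⟨ cong parity (m∸n+n≡m k≤n) ⟩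
  parity n                    ≡⟨ n-even ⟩
  0ℙ                          ∎)) (ℙ.+-identityʳ (parity k))
  where open ≡-Reasoning

x+1+1≡x : ∀ p → p ℙ.+ 1ℙ ℙ.+ 1ℙ ≡ p
x+1+1≡x 0ℙ = refl
x+1+1≡x 1ℙ = refl

odd⇒>0 : ∀ {m} → parity m ≡ 1ℙ → 0 < m
odd⇒>0 {suc m} _ = s≤s z≤n

insertAt : ℕ → A → List A → List A
insertAt k a xs = take k xs ++ a ∷ drop k xs

rotate : ℕ → List A → List A
rotate k xs = drop k xs ++ take k xs

take-length-++ : (xs ys : List A) → take (length xs) (xs ++ ys) ≡ xs
take-length-++ []       ys = refl
take-length-++ (x ∷ xs) ys = cong (x ∷_) (take-length-++ xs ys)

drop-length-++ : (xs ys : List A) → drop (length xs) (xs ++ ys) ≡ ys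
drop-length-++ []       ys = refl
drop-length-++ (x ∷ xs) ys = drop-length-++ xs ys

length-take-≤ : ∀ {k} (xs : List A) → k ≤ length xs → length (take k xs) ≡ k
length-take-≤ {k = k} xs k≤ = trans (length-take k xs) (m≤n⇒m⊓n≡m k≤)

∈-take : ∀ {x : A} k {xs} → x ∈ take k xs → x ∈ xs
∈-take k {xs} x∈ = subst (_ ∈_) (take++drop≡id k xs) (∈-++⁺ˡ x∈)

insertAt-++ : ∀ (a : A) xs ys → insertAt (length xs) a (xs ++ ys) ≡ xs ++ a ∷ ys
insertAt-++ a xs ys = cong₂ (λ u v → u ++ a ∷ v) (take-length-++ xs ys) (drop-length-++ xs ys)

rotate-++ : (xs ys : List A) → rotate (length xs) (xs ++ ys) ≡ ys ++ xs
rotate-++ xs ys = cong₂ _++_ (drop-length-++ xs ys) (take-length-++ xs ys)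

map-insertAt : ∀ {B : Set} (f : A → B) k a xs → map f (insertAt k a xs) ≡ insertAt k (f a) (map f xs)
map-insertAt f k a xs = trans (map-++ f (take k xs) (a ∷ drop k xs))
  (cong₂ (λ u v → u ++ f a ∷ v) (sym (take-map k xs)) (sym (drop-map k xs)))

Unique-↭ : {xs ys : List A} → xs ↭ ys → Unique xs → Unique ys
Unique-↭ {A} xs↭ys = Unique-resp-↭ (setoid A) (↭⇒↭ₛ xs↭ys)

insertAt-↭ : ∀ k (a : A) xs → insertAt k a xs ↭ a ∷ xs
insertAt-↭ k a xs =
  subst (λ ys → insertAt k a xs ↭ a ∷ ys) (take++drop≡id k xs) (↭.shift a (take k xs) (drop k xs))

rotate-↭ : ∀ k (xs : List A) → rotate k xs ↭ xs
rotate-↭ k xs = subst (rotate k xs ↭_) (take++drop≡id k xs) (↭.++-comm (drop k xs) (take k xs))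

rotate-involutive : ∀ k (xs : List A) → rotate (length xs ∸ k) (rotate k xs) ≡ xs
rotate-involutive k xs = begin
  rotate (length xs ∸ k) (drop k xs ++ take k xs)
    ≡⟨ cong (λ m → rotate m (drop k xs ++ take k xs)) (sym (length-drop k xs)) ⟩
  rotate (length (drop k xs)) (drop k xs ++ take k xs)   ≡⟨ rotate-++ (drop k xs) (take k xs) ⟩
  take k xs ++ drop k xs                                 ≡⟨ take++drop≡id k xs ⟩
  xs                                                     ∎
  where open ≡-Reasoning

Unique-++-disjoint : ∀ {xs ys : List A} → Unique (xs ++ ys) → ∀ {a b} → a ∈ xs → b ∈ ys → a ≢ b
Unique-++-disjoint {xs = x ∷ xs} (x∉ ∷ _)  (here refl) b∈ = All.lookup x∉ (∈-++⁺ʳ xs b∈)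
Unique-++-disjoint {xs = x ∷ xs} (_ ∷ xs!) (there a∈)  b∈ = Unique-++-disjoint xs! a∈ b∈

++-∷-injective : ∀ {a : A} xs ys {us vs} → a ∉ xs → a ∉ ys →
                 xs ++ a ∷ us ≡ ys ++ a ∷ vs → xs ≡ ys × us ≡ vs
++-∷-injective []       []       a∉xs a∉ys refl = refl , refl
++-∷-injective []       (y ∷ ys) a∉xs a∉ys eq with refl ← proj₁ (∷-injective eq) = ⊥-elim (a∉ys (here refl))
++-∷-injective (x ∷ xs) []       a∉xs a∉ys eq with refl ← proj₁ (∷-injective eq) = ⊥-elim (a∉xs (here refl))
++-∷-injective (x ∷ xs) (y ∷ ys) a∉xs a∉ys eq with refl , eq′ ← ∷-injective eq
  with refl , refl ← ++-∷-injective xs ys (a∉xs ∘ there) (a∉ys ∘ there) eq′ = refl , refl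

insertAt-injective : ∀ {a : A} {k k′ xs ys} → a ∉ xs → a ∉ ys → k ≤ length xs → k′ ≤ length ys →
                     insertAt k a xs ≡ insertAt k′ a ys → k ≡ k′ × xs ≡ ys
insertAt-injective {k = k} {k′} {xs} {ys} a∉xs a∉ys k≤ k′≤ eq
  with take≡ , drop≡ ← ++-∷-injective (take k xs) (take k′ ys) (a∉xs ∘ ∈-take k) (a∉ys ∘ ∈-take k′) eq =
  trans (sym (length-take-≤ xs k≤)) (trans (cong length take≡) (length-take-≤ ys k′≤)) ,
  trans (sym (take++drop≡id k xs)) (trans (cong₂ _++_ take≡ drop≡) (take++drop≡id k′ ys))

⊆-length : {xs ys : List A} → Unique xs → (∀ {x} → x ∈ xs → x ∈ ys) → length xs ≤ length ys
⊆-length {xs = []}     _            _  = z≤n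
⊆-length {xs = x ∷ xs} {ys} (x∉xs ∷ xs!) xs⊆ys with ∈-∃++ (xs⊆ys (here refl))
... | ys₁ , ys₂ , refl = ≤-trans (s≤s (⊆-length xs! xs⊆ys₁ys₂)) (≤-reflexive (sym length-split))
  where
  xs⊆ys₁ys₂ : ∀ {z} → z ∈ xs → z ∈ ys₁ ++ ys₂
  xs⊆ys₁ys₂ z∈ with ∈-++⁻ ys₁ (xs⊆ys (there z∈))
  ... | inj₁ z∈ys₁         = ∈-++⁺ˡ z∈ys₁
  ... | inj₂ (here z≡x)    = ⊥-elim (All.lookup x∉xs z∈ (sym z≡x))
  ... | inj₂ (there z∈ys₂) = ∈-++⁺ʳ ys₁ z∈ys₂
  length-split : length (ys₁ ++ x ∷ ys₂) ≡ suc (length (ys₁ ++ ys₂))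
  length-split = trans (length-++ ys₁) (trans (+-suc (length ys₁) _) (cong suc (sym (length-++ ys₁))))

Unique-concatMap : {B : Set} (f : A → List B) {xs : List A} → Unique xs → (∀ x → Unique (f x)) →
                   (∀ {x y z} → z ∈ f x → z ∈ f y → x ≡ y) → Unique (concatMap f xs)
Unique-concatMap f {[]}     []           f! f# = []
Unique-concatMap f {x ∷ xs} (x∉xs ∷ xs!) f! f# =
  Unique.++⁺ (f! x) (Unique-concatMap f xs! f! f#) disjoint
  where
  disjoint : ∀ {v} → ¬ (v ∈ f x × v ∈ concatMap f xs)
  disjoint (v∈fx , v∈rest) with find (∈-concatMap⁻ f v∈rest)
  ... | y , y∈xs , v∈fy = All.lookup x∉xs y∈xs (f# v∈fx v∈fy)

-- Descents, ascents and inversions of lists of naturals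

desN : List ℕ → ℕ
desN (x ∷ y ∷ r) = 𝟙 (does (y <? x)) + desN (y ∷ r)
desN _           = 0

ascN : List ℕ → ℕ
ascN (x ∷ y ∷ r) = 𝟙 (not (does (y <? x))) + ascN (y ∷ r)
ascN _           = 0

invN : List ℕ → ℕ
invN []      = 0
invN (x ∷ r) = ∑[ y ∈ r ] 𝟙 (does (y <? x)) + invN r

ascN+desN : ∀ x r → ascN (x ∷ r) + desN (x ∷ r) ≡ length r
ascN+desN x []      = refl
ascN+desN x (y ∷ r) with does (y <? x)
... | false = cong suc (ascN+desN y r)
... | true  = trans (+-suc (ascN (y ∷ r)) _) (cong suc (ascN+desN y r))

module _ {M : ℕ} where

  private
    below : ∀ {x} → x < M → does (M <? x) ≡ false
    below x<M = dec-false (_ <? _) (<⇒≯ x<M)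

    above : ∀ {x} → x < M → does (x <? M) ≡ true
    above x<M = dec-true (_ <? _) x<M

  insertAfterHead-stats : (f : ℕ → ℕ → ℕ) (x : ℕ) (r : List ℕ) → All (_< M) (x ∷ r) →
    ∑[ k ∈ upTo (suc (length r)) ] f (ascN (insertAt (suc k) M (x ∷ r))) (desN (insertAt (suc k) M (x ∷ r)))
    ≡ ascN (x ∷ r) * f (ascN (x ∷ r)) (suc (desN (x ∷ r)))
      + suc (desN (x ∷ r)) * f (suc (ascN (x ∷ r))) (desN (x ∷ r))
  -- f is generalised so that the induction hypothesis can absorb the step at (x , y)
  insertAfterHead-stats f x [] (x<M ∷ []) rewrite below x<M = refl
  insertAfterHead-stats f x (y ∷ r) (x<M ∷ y<M ∷ r<M)
    rewrite ∑-upTo-suc (suc (length r))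
              (λ k → f (ascN (insertAt (suc k) M (x ∷ y ∷ r))) (desN (insertAt (suc k) M (x ∷ y ∷ r))))
          | insertAfterHead-stats (λ a d → f (𝟙 (not (does (y <? x))) + a) (𝟙 (does (y <? x)) + d)) y r (y<M ∷ r<M)
          | below x<M | above y<M
    with does (y <? x)
  ... | false = sym (+-assoc (f (suc a) (suc d)) (a * f (suc a) (suc d)) _)
    where
    a d : ℕ
    a = ascN (y ∷ r)
    d = desN (y ∷ r)
  ... | true  = x+[y+z]≡y+[x+z] (f (suc a) (suc d)) (a * f a (suc (suc d))) _
    where
    a d : ℕ
    a = ascN (y ∷ r)
    d = desN (y ∷ r)

  insertAt-stats : (f : ℕ → ℕ → ℕ) (x : ℕ) (r : List ℕ) → All (_< M) (x ∷ r) →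
    ∑[ k ∈ upTo (suc (length (x ∷ r))) ] f (ascN (insertAt k M (x ∷ r))) (desN (insertAt k M (x ∷ r)))
    ≡ suc (ascN (x ∷ r)) * f (ascN (x ∷ r)) (suc (desN (x ∷ r)))
      + suc (desN (x ∷ r)) * f (suc (ascN (x ∷ r))) (desN (x ∷ r))
  insertAt-stats f x r x∷r<M@(x<M ∷ _)
    rewrite ∑-upTo-suc (length (x ∷ r)) (λ k → f (ascN (insertAt k M (x ∷ r))) (desN (insertAt k M (x ∷ r))))
          | insertAfterHead-stats f x r x∷r<M
          | above x<M
    = sym (+-assoc (f (ascN (x ∷ r)) (suc (desN (x ∷ r)))) _ _)

  invN-insertAt : ∀ k (l : List ℕ) → All (_< M) l → k ≤ length l →
                  invN (insertAt k M l) ≡ invN l + (length l ∸ k)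
  invN-insertAt zero l l<M _ = trans (cong (_+ invN l) all-below) (+-comm (length l) (invN l))
    where
    all-below : ∑[ y ∈ l ] 𝟙 (does (y <? M)) ≡ length l
    all-below = trans (∑-cong l (λ y∈l → cong 𝟙 (above (All.lookup l<M y∈l))))
                      (trans (∑-const l 1) (*-identityʳ (length l)))
  invN-insertAt (suc k) (x ∷ l) (x<M ∷ l<M) (s≤s k≤l) = begin
    ∑[ y ∈ insertAt k M l ] 𝟙 (does (y <? x)) + invN (insertAt k M l)
      ≡⟨ cong₂ _+_ crossings-unchanged (invN-insertAt k l l<M k≤l) ⟩
    ∑[ y ∈ l ] 𝟙 (does (y <? x)) + (invN l + (length l ∸ k))
      ≡⟨ sym (+-assoc (∑[ y ∈ l ] 𝟙 (does (y <? x))) (invN l) _) ⟩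
    ∑[ y ∈ l ] 𝟙 (does (y <? x)) + invN l + (length l ∸ k) ∎
    where
    open ≡-Reasoning
    g : ℕ → ℕ
    g y = 𝟙 (does (y <? x))
    crossings-unchanged : ∑ (insertAt k M l) g ≡ ∑ l g
    crossings-unchanged = begin
      ∑ (take k l ++ M ∷ drop k l) g           ≡⟨ ∑-++ (take k l) (M ∷ drop k l) g ⟩
      ∑ (take k l) g + (g M + ∑ (drop k l) g)
        ≡⟨ cong (λ b → ∑ (take k l) g + (𝟙 b + ∑ (drop k l) g)) (below x<M) ⟩
      ∑ (take k l) g + ∑ (drop k l) g           ≡⟨ sym (∑-++ (take k l) (drop k l) g) ⟩
      ∑ (take k l ++ drop k l) g                ≡⟨ cong (λ xs → ∑ xs g) (take++drop≡id k l) ⟩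
      ∑ l g                                     ∎

  desN-around : ∀ x X y Y → All (_< M) (x ∷ X) → y < M →
                desN ((x ∷ X) ++ M ∷ y ∷ Y) ≡ suc (desN (x ∷ X) + desN (y ∷ Y))
  desN-around x []       y Y (x<M ∷ [])  y<M rewrite below x<M | above y<M = refl
  desN-around x (x′ ∷ X) y Y (_ ∷ X<M) y<M =
    trans (cong (𝟙 (does (x′ <? x)) +_) (desN-around x′ X y Y X<M y<M))
          (trans (+-suc (𝟙 (does (x′ <? x))) _) (cong suc (sym (+-assoc (𝟙 (does (x′ <? x))) _ _))))

  desN-swap : ∀ X Y → All (_< M) X → All (_< M) Y → 0 < length X → 0 < length Y →
              desN (X ++ M ∷ Y) ≡ desN (Y ++ M ∷ X)
  desN-swap (x ∷ X) (y ∷ Y) X<M@(x<M ∷ _) Y<M@(y<M ∷ _) _ _ = begin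
    desN ((x ∷ X) ++ M ∷ y ∷ Y)          ≡⟨ desN-around x X y Y X<M y<M ⟩
    suc (desN (x ∷ X) + desN (y ∷ Y))    ≡⟨ cong suc (+-comm (desN (x ∷ X)) _) ⟩
    suc (desN (y ∷ Y) + desN (x ∷ X))    ≡⟨ sym (desN-around y Y x X Y<M x<M) ⟩
    desN ((y ∷ Y) ++ M ∷ x ∷ X)          ∎
    where open ≡-Reasoning

crossings : List ℕ → List ℕ → ℕ
crossings A B = ∑[ a ∈ A ] ∑[ b ∈ B ] 𝟙 (does (b <? a))

invN-++ : ∀ A B → invN (A ++ B) ≡ invN A + invN B + crossings A B
invN-++ []      B = sym (+-identityʳ (invN B))
invN-++ (a ∷ A) B = begin
  ∑ (A ++ B) g + invN (A ++ B)                   ≡⟨ cong₂ _+_ (∑-++ A B g) (invN-++ A B) ⟩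
  ∑ A g + ∑ B g + (invN A + invN B + crossings A B)
    ≡⟨ solve 5 (λ p q r s t → p :+ q :+ (r :+ s :+ t) := p :+ r :+ s :+ (q :+ t)) refl
               (∑ A g) (∑ B g) (invN A) (invN B) (crossings A B) ⟩
  ∑ A g + invN A + invN B + (∑ B g + crossings A B) ∎
  where
  open ≡-Reasoning
  open +-*-Solver
  g : ℕ → ℕ
  g b = 𝟙 (does (b <? a))

𝟙-<?-flip : ∀ {a b} → a ≢ b → 𝟙 (does (b <? a)) + 𝟙 (does (a <? b)) ≡ 1
𝟙-<?-flip {a} {b} a≢b with <-cmp a b
... | tri< a<b _ _ rewrite dec-false (b <? a) (<⇒≯ a<b) | dec-true (a <? b) a<b = refl
... | tri≈ _ a≡b _ = ⊥-elim (a≢b a≡b)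
... | tri> _ _ b<a rewrite dec-true (b <? a) b<a | dec-false (a <? b) (<⇒≯ b<a) = refl

crossings-swap : ∀ A B → (∀ {a b} → a ∈ A → b ∈ B → a ≢ b) →
                 crossings A B + crossings B A ≡ length A * length B
crossings-swap A B A#B = begin
  crossings A B + crossings B A
    ≡⟨ cong (crossings A B +_) (∑-comm B A (λ b a → 𝟙 (does (a <? b)))) ⟩
  crossings A B + ∑[ a ∈ A ] ∑[ b ∈ B ] 𝟙 (does (a <? b))
    ≡⟨ sym (∑-+ A _ _) ⟩
  ∑[ a ∈ A ] (∑[ b ∈ B ] 𝟙 (does (b <? a)) + ∑[ b ∈ B ] 𝟙 (does (a <? b)))
    ≡⟨ ∑-cong A (λ a∈A → trans (sym (∑-+ B _ _)) (∑-cong B (λ b∈B → 𝟙-<?-flip (A#B a∈A b∈B)))) ⟩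
  ∑[ a ∈ A ] ∑[ b ∈ B ] 1
    ≡⟨ ∑-cong A (λ _ → trans (∑-const B 1) (*-identityʳ (length B))) ⟩
  ∑[ a ∈ A ] length B
    ≡⟨ ∑-const A (length B) ⟩
  length A * length B ∎
  where open ≡-Reasoning

parity-invN-swap : ∀ A B → (∀ {a b} → a ∈ A → b ∈ B → a ≢ b) →
                   parity (invN (B ++ A)) ≡ parity (invN (A ++ B)) ℙ.+ parity (length A * length B)
parity-invN-swap A B A#B = x+y≡z⇒y≡x+z (parity (invN (A ++ B))) (begin
  parity (invN (A ++ B)) ℙ.+ parity (invN (B ++ A))   ≡⟨ sym (ℙ.+-homo-+ (invN (A ++ B)) _) ⟩
  parity (invN (A ++ B) + invN (B ++ A))               ≡⟨ cong parity total ⟩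
  parity (2 * (invN A + invN B) + length A * length B) ≡⟨ ℙ.+-homo-+ (2 * (invN A + invN B)) _ ⟩
  parity (2 * (invN A + invN B)) ℙ.+ parity (length A * length B)
    ≡⟨ cong (ℙ._+ parity (length A * length B)) (ℙ.*-homo-* 2 (invN A + invN B)) ⟩
  parity (length A * length B) ∎)
  where
  open ≡-Reasoning
  open +-*-Solver
  total : invN (A ++ B) + invN (B ++ A) ≡ 2 * (invN A + invN B) + length A * length B
  total = begin
    invN (A ++ B) + invN (B ++ A)
      ≡⟨ cong₂ _+_ (invN-++ A B) (invN-++ B A) ⟩
    invN A + invN B + crossings A B + (invN B + invN A + crossings B A)
      ≡⟨ solve 4 (λ a b c d → a :+ b :+ c :+ (b :+ a :+ d) := con 2 :* (a :+ b) :+ (c :+ d)) refl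
                 (invN A) (invN B) (crossings A B) (crossings B A) ⟩
    2 * (invN A + invN B) + (crossings A B + crossings B A)
      ≡⟨ cong (2 * (invN A + invN B) +_) (crossings-swap A B A#B) ⟩
    2 * (invN A + invN B) + length A * length B ∎

toℕs : List (Fin n) → List ℕ
toℕs = map toℕ

des-toℕs : (σ : List (Fin n)) → des σ ≡ desN (toℕs σ)
des-toℕs []          = refl
des-toℕs (x ∷ [])    = refl
des-toℕs (x ∷ y ∷ r) = trans (descent-step x y r) (cong (𝟙 (does (toℕ y <? toℕ x)) +_) (des-toℕs (y ∷ r)))
  where
  descent-step : (x y : Fin n) (r : List (Fin n)) → des (x ∷ y ∷ r) ≡ 𝟙 (does (toℕ y <? toℕ x)) + des (y ∷ r)
  descent-step x y r with toℕ y <? toℕ x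
  ... | yes y<x rewrite dec-true  (toℕ y <? toℕ x) y<x = refl
  ... | no  y≮x rewrite dec-false (toℕ y <? toℕ x) y≮x = refl

inv-toℕs : (σ : List (Fin n)) → inv σ ≡ invN (toℕs σ)
inv-toℕs []      = refl
inv-toℕs (x ∷ r) =
  cong₂ _+_ (trans (length-filter (λ y → toℕ y <? toℕ x) r) (sym (∑-map toℕ r _))) (inv-toℕs r)

asc-toℕs : (σ : List (Fin (suc n))) → length σ ≡ suc n → asc σ ≡ ascN (toℕs σ)
asc-toℕs {n} σ@(x ∷ r) |σ|≡1+n = begin
  n ∸ des σ                                    ≡⟨ cong (n ∸_) (des-toℕs σ) ⟩
  n ∸ desN (toℕs σ)                            ≡⟨ cong (_∸ desN (toℕs σ)) (sym a+d≡n) ⟩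
  ascN (toℕs σ) + desN (toℕs σ) ∸ desN (toℕs σ) ≡⟨ m+n∸n≡m (ascN (toℕs σ)) (desN (toℕs σ)) ⟩
  ascN (toℕs σ)                                ∎
  where
  open ≡-Reasoning
  a+d≡n : ascN (toℕs σ) + desN (toℕs σ) ≡ n
  a+d≡n = trans (ascN+desN (toℕ x) (toℕs r)) (trans (length-map toℕ r) (suc-injective |σ|≡1+n))

∈-words : ∀ k (w : List (Fin n)) → length w ≡ k → w ∈ words k n
∈-words zero    []      refl = here refl
∈-words (suc k) (x ∷ w) refl =
  ∈-concatMap⁺ _ (Any.map (λ { refl → ∈-map⁺ (_∷ w) (∈-allFin x) }) (∈-words k w refl))

length-∈-words : ∀ k {w : List (Fin n)} → w ∈ words k n → length w ≡ k
length-∈-words zero    (here refl) = refl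
length-∈-words {n} (suc k) w∈ with find (∈-concatMap⁻ (λ w → map (_∷ w) (allFin n)) {xs = words k n} w∈)
... | w′ , w′∈ , w∈map with ∈-map⁻ (_∷ w′) w∈map
... | x , _ , refl = cong suc (length-∈-words k w′∈)

Unique-words : ∀ k n → Unique (words k n)
Unique-words zero    n = [] ∷ []
Unique-words (suc k) n = Unique-concatMap _ (Unique-words k n)
  (λ w → Unique.map⁺ (proj₁ ∘ ∷-injective) (Unique.allFin⁺ n)) same-tail
  where
  same-tail : ∀ {w w′ : List (Fin n)} {z} → z ∈ map (_∷ w) (allFin n) → z ∈ map (_∷ w′) (allFin n) → w ≡ w′
  same-tail z∈ z∈′ with ∈-map⁻ _ z∈ | ∈-map⁻ _ z∈′
  ... | _ , _ , refl | _ , _ , eq = proj₂ (∷-injective eq)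

∈-perms⁻ : {σ : List (Fin n)} → σ ∈ perms n → length σ ≡ n × Unique σ
∈-perms⁻ {n} σ∈ with ∈-filter⁻ (UniqueDec.unique? (_≟ᶠ_ {n})) {xs = words n n} σ∈
... | σ∈words , σ! = length-∈-words n σ∈words , σ!

∈-perms⁺ : {σ : List (Fin n)} → length σ ≡ n → Unique σ → σ ∈ perms n
∈-perms⁺ {n} {σ} |σ|≡n σ! = ∈-filter⁺ (UniqueDec.unique? (_≟ᶠ_ {n})) (∈-words n σ |σ|≡n) σ!

Unique-perms : ∀ n → Unique (perms n)
Unique-perms n = Unique.filter⁺ (UniqueDec.unique? (_≟ᶠ_ {n})) (Unique-words n n)

-- Inserting the maximum

slots : (n : ℕ) → List (List (Fin n) × ℕ)
slots n = cartesianProduct (perms n) (upTo (suc n))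

∈-slots⁻ : ∀ {π : List (Fin n)} {k} → (π , k) ∈ slots n → π ∈ perms n × k ≤ n
∈-slots⁻ {n} p∈ with π∈ , k∈ ← ∈-cartesianProduct⁻ (perms n) (upTo (suc n)) p∈ = π∈ , s≤s⁻¹ (∈-upTo⁻ k∈)

∈-slots⁺ : ∀ {π : List (Fin n)} {k} → π ∈ perms n → k ≤ n → (π , k) ∈ slots n
∈-slots⁺ π∈ k≤n = ∈-cartesianProduct⁺ π∈ (∈-upTo⁺ (s≤s k≤n))

Unique-slots : ∀ n → Unique (slots n)
Unique-slots n = Unique.cartesianProduct⁺ (Unique-perms n) (Unique.upTo⁺ (suc n))

insertMax : List (Fin n) × ℕ → List (Fin (suc n))
insertMax {n} (π , k) = insertAt k (fromℕ n) (map inject₁ π)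

toℕs-inject₁ : (π : List (Fin n)) → toℕs (map inject₁ π) ≡ toℕs π
toℕs-inject₁ []      = refl
toℕs-inject₁ (x ∷ π) = cong₂ _∷_ (toℕ-inject₁ x) (toℕs-inject₁ π)

toℕs-insertMax : ∀ (π : List (Fin n)) k → toℕs (insertMax (π , k)) ≡ insertAt k n (toℕs π)
toℕs-insertMax {n} π k = begin
  toℕs (insertAt k (fromℕ n) (map inject₁ π))            ≡⟨ map-insertAt toℕ k (fromℕ n) (map inject₁ π) ⟩
  insertAt k (toℕ (fromℕ n)) (toℕs (map inject₁ π))      ≡⟨ cong₂ (insertAt k) (toℕ-fromℕ n) (toℕs-inject₁ π) ⟩
  insertAt k n (toℕs π)                                   ∎
  where open ≡-Reasoning

des-insertMax : ∀ (π : List (Fin n)) k → des (insertMax (π , k)) ≡ desN (insertAt k n (toℕs π))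
des-insertMax π k = trans (des-toℕs (insertMax (π , k))) (cong desN (toℕs-insertMax π k))

inv-insertMax : ∀ (π : List (Fin n)) k → inv (insertMax (π , k)) ≡ invN (insertAt k n (toℕs π))
inv-insertMax π k = trans (inv-toℕs (insertMax (π , k))) (cong invN (toℕs-insertMax π k))

toℕs<n : (π : List (Fin n)) → All (_< n) (toℕs π)
toℕs<n []      = []
toℕs<n (x ∷ π) = toℕ<n x ∷ toℕs<n π

length-insertMax : ∀ (π : List (Fin n)) k → length (insertMax (π , k)) ≡ suc (length π)
length-insertMax {n} π k =
  trans (↭.↭-length (insertAt-↭ k (fromℕ n) (map inject₁ π))) (cong suc (length-map inject₁ π))

fromℕ≢inject₁s : (π : List (Fin n)) → All (fromℕ n ≢_) (map inject₁ π)
fromℕ≢inject₁s []      = []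
fromℕ≢inject₁s (x ∷ π) = fromℕ≢inject₁ ∷ fromℕ≢inject₁s π

lower₁s : (xs : List (Fin (suc n))) → All (fromℕ n ≢_) xs → Σ (List (Fin n)) λ π → map inject₁ π ≡ xs
lower₁s []       []             = [] , refl
lower₁s {n} (x ∷ xs) (x≢max ∷ xs≢max) with lower₁s xs xs≢max
... | π , refl = lower₁ x n≢x ∷ π , cong (_∷ map inject₁ π) (inject₁-lower₁ x n≢x)
  where
  n≢x : n ≢ toℕ x
  n≢x n≡x = x≢max (toℕ-injective (trans (toℕ-fromℕ n) n≡x))

fromℕ-∈ : (σ : List (Fin (suc n))) → length σ ≡ suc n → Unique σ → fromℕ n ∈ σ
fromℕ-∈ {n} σ |σ|≡1+n σ! with DecMembership._∈?_ _≟ᶠ_ (fromℕ n) σ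
... | yes max∈σ = max∈σ
... | no  max∉σ = ⊥-elim (<-irrefl refl (begin-strict
  n                                 <⟨ ≤-reflexive (sym |σ|≡1+n) ⟩
  length σ                          ≤⟨ ⊆-length σ! σ⊆inject₁s ⟩
  length (map inject₁ (allFin n))   ≡⟨ trans (length-map inject₁ (allFin n)) (length-tabulate _) ⟩
  n                                 ∎))
  where
  open ≤-Reasoning
  σ⊆inject₁s : ∀ {x} → x ∈ σ → x ∈ map inject₁ (allFin n)
  σ⊆inject₁s {x} x∈σ with lower₁s (x ∷ []) ((λ max≡x → max∉σ (subst (_∈ σ) (sym max≡x) x∈σ)) ∷ [])
  ... | y ∷ [] , refl = ∈-map⁺ inject₁ (∈-allFin y)

insertMax-∈-perms : ∀ {π : List (Fin n)} k → π ∈ perms n → insertMax (π , k) ∈ perms (suc n)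
insertMax-∈-perms {n} {π} k π∈ with |π|≡n , π! ← ∈-perms⁻ π∈ = ∈-perms⁺
  (trans (length-insertMax π k) (cong suc |π|≡n))
  (Unique-↭ (↭-sym (insertAt-↭ k (fromℕ n) (map inject₁ π)))
            (fromℕ≢inject₁s π ∷ Unique.map⁺ inject₁-injective π!))

insertMax-injective : ∀ {p q} → p ∈ slots n → q ∈ slots n →
                      insertMax p ≡ insertMax q → p ≡ q
insertMax-injective {n} {π , k} {π′ , k′} p∈ q∈ eq =
  cong₂ _,_ (map-injective inject₁-injective (proj₂ k≡k′×π≡π′)) (proj₁ k≡k′×π≡π′)
  where
  slot≤length : ∀ {ρ j} → (ρ , j) ∈ slots n → j ≤ length (map inject₁ ρ)
  slot≤length {ρ} r∈ with ρ∈ , j≤n ← ∈-slots⁻ r∈ =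
    ≤-trans j≤n (≤-reflexive (sym (trans (length-map inject₁ ρ) (proj₁ (∈-perms⁻ ρ∈)))))
  k≡k′×π≡π′ : k ≡ k′ × map inject₁ π ≡ map inject₁ π′
  k≡k′×π≡π′ = insertAt-injective (All¬⇒¬Any (fromℕ≢inject₁s π)) (All¬⇒¬Any (fromℕ≢inject₁s π′))
                                 (slot≤length p∈) (slot≤length q∈) eq

insertMax-surjective : ∀ {σ} → σ ∈ perms (suc n) → Σ (List (Fin n) × ℕ) λ p → p ∈ slots n × σ ≡ insertMax p
insertMax-surjective {n} {σ} σ∈
  with |σ|≡1+n , σ! ← ∈-perms⁻ σ∈
  with A , B , refl ← ∈-∃++ (fromℕ-∈ σ |σ|≡1+n σ!)
  with max∉AB ∷ AB! ← Unique-↭ (↭.shift (fromℕ n) A B) σ!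
  with π , π≡AB ← lower₁s (A ++ B) max∉AB
  = (π , length A) , ∈-slots⁺ π∈ |A|≤n ,
    sym (trans (cong (insertAt (length A) (fromℕ n)) π≡AB) (insertAt-++ (fromℕ n) A B))
  where
  |AB|≡n : length (A ++ B) ≡ n
  |AB|≡n = suc-injective (trans (sym (↭.↭-length (↭.shift (fromℕ n) A B))) |σ|≡1+n)
  π∈ : π ∈ perms n
  π∈ = ∈-perms⁺ (trans (sym (length-map inject₁ π)) (trans (cong length π≡AB) |AB|≡n))
                (Unique.map⁻ (subst Unique (sym π≡AB) AB!))
  |A|≤n : length A ≤ n
  |A|≤n = ≤-trans (m≤m+n (length A) (length B)) (≤-reflexive (trans (sym (length-++ A)) |AB|≡n))

∑-perms-suc : ∀ n (f : List (Fin (suc n)) → ℕ) → ∑ (perms (suc n)) f ≡ ∑ (slots n) (f ∘ insertMax)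
∑-perms-suc n f = ∑-bijection insertMax (Unique-slots n) (Unique-perms (suc n))
  insertMax-injective (λ {p} p∈ → insertMax-∈-perms (proj₂ p) (proj₁ (∈-slots⁻ p∈))) insertMax-surjective f

insertMax-stats : ∀ {n} (f : ℕ → ℕ → ℕ) {π : List (Fin (suc n))} → π ∈ perms (suc n) →
  ∑[ k ∈ upTo (suc (suc n)) ] f (asc (insertMax (π , k))) (des (insertMax (π , k)))
  ≡ suc (asc π) * f (asc π) (suc (des π)) + suc (des π) * f (suc (asc π)) (des π)
insertMax-stats f {[]} π∈ with () ← proj₁ (∈-perms⁻ π∈)
insertMax-stats {n} f {π@(x ∷ r)} π∈ = begin
  ∑[ k ∈ upTo (suc (suc n)) ] f (asc (insertMax (π , k))) (des (insertMax (π , k)))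
    ≡⟨ ∑-cong (upTo (suc (suc n))) (λ {k} _ → cong₂ f (asc-insertMax k) (des-insertMax π k)) ⟩
  ∑[ k ∈ upTo (suc (suc n)) ] fN (insertAt k (suc n) l)
    ≡⟨ cong (λ m → ∑[ k ∈ upTo (suc m) ] fN (insertAt k (suc n) l)) (sym |l|) ⟩
  ∑[ k ∈ upTo (suc (length l)) ] fN (insertAt k (suc n) l)
    ≡⟨ insertAt-stats f (toℕ x) (toℕs r) (toℕs<n π) ⟩
  suc (ascN l) * f (ascN l) (suc (desN l)) + suc (desN l) * f (suc (ascN l)) (desN l)
    ≡⟨ cong₂ (λ a d → suc a * f a (suc d) + suc d * f (suc a) d)
             (sym (asc-toℕs π |π|)) (sym (des-toℕs π)) ⟩
  suc (asc π) * f (asc π) (suc (des π)) + suc (des π) * f (suc (asc π)) (des π) ∎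
  where
  open ≡-Reasoning
  l : List ℕ
  l = toℕs π
  fN : List ℕ → ℕ
  fN xs = f (ascN xs) (desN xs)
  |π| : length π ≡ suc n
  |π| = proj₁ (∈-perms⁻ π∈)
  |l| : length l ≡ suc n
  |l| = trans (length-map toℕ π) |π|
  asc-insertMax : ∀ k → asc (insertMax (π , k)) ≡ ascN (insertAt k (suc n) l)
  asc-insertMax k = trans (asc-toℕs (insertMax (π , k)) (trans (length-insertMax π k) (cong suc |π|)))
                          (cong ascN (toℕs-insertMax π k))
-- Exchanging the blocks around the maximum

rotate-∈-slots : ∀ {π : List (Fin n)} {k} → (π , k) ∈ slots n → (rotate k π , n ∸ k) ∈ slots n
rotate-∈-slots {n} {π} {k} p∈ with π∈ , _ ← ∈-slots⁻ p∈ with |π|≡n , π! ← ∈-perms⁻ π∈ =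
  ∈-slots⁺ (∈-perms⁺ (trans (↭.↭-length (rotate-↭ k π)) |π|≡n) (Unique-↭ (↭-sym (rotate-↭ k π)) π!))
           (m∸n≤m n k)

weight : (Parity → ℕ → ℕ → ℕ) → List (Fin n) → ℕ
weight W σ = W (parity (inv σ)) (asc σ) (des σ)

-- On σ = A ++ n ∷ B with |A| = k odd this is σ ↦ B ++ n ∷ A.
swapOddBlocks : (n : ℕ) → List (Fin n) × ℕ → List (Fin n) × ℕ
swapOddBlocks n (π , k) with parity k
... | 0ℙ = π , k
... | 1ℙ = rotate k π , n ∸ k

module _ {n : ℕ} (n-even : parity n ≡ 0ℙ) where

  swapOddBlocks-∈ : ∀ {p} → p ∈ slots n → swapOddBlocks n p ∈ slots n
  swapOddBlocks-∈ {π , k} p∈ with parity k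
  ... | 0ℙ = p∈
  ... | 1ℙ = rotate-∈-slots p∈

  swapOddBlocks-involutive : ∀ {p} → p ∈ slots n → swapOddBlocks n (swapOddBlocks n p) ≡ p
  swapOddBlocks-involutive {π , k} p∈ with parity k in k-parity
  ... | 0ℙ rewrite k-parity = refl
  ... | 1ℙ with π∈ , k≤n ← ∈-slots⁻ p∈ with |π|≡n , _ ← ∈-perms⁻ π∈
    rewrite parity-∸ n-even k≤n | k-parity =
    cong₂ _,_ (subst (λ m → rotate (m ∸ k) (rotate k π) ≡ π) |π|≡n (rotate-involutive k π)) (m∸[m∸n]≡n k≤n)

  parity-inv-insertMax : ∀ {π k} → (π , k) ∈ slots n →
                         parity (inv (insertMax (π , k))) ≡ parity (inv π) ℙ.+ parity k
  parity-inv-insertMax {π} {k} p∈ with π∈ , k≤n ← ∈-slots⁻ p∈ with |π|≡n , _ ← ∈-perms⁻ π∈ = begin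
    parity (inv (insertMax (π , k)))          ≡⟨ cong parity (inv-insertMax π k) ⟩
    parity (invN (insertAt k n l))            ≡⟨ cong parity (invN-insertAt k l (toℕs<n π) k≤|l|) ⟩
    parity (invN l + (length l ∸ k))          ≡⟨ ℙ.+-homo-+ (invN l) _ ⟩
    parity (invN l) ℙ.+ parity (length l ∸ k) ≡⟨ cong₂ (λ i m → parity i ℙ.+ parity (m ∸ k)) (sym (inv-toℕs π)) |l| ⟩
    parity (inv π) ℙ.+ parity (n ∸ k)         ≡⟨ cong (parity (inv π) ℙ.+_) (parity-∸ n-even k≤n) ⟩
    parity (inv π) ℙ.+ parity k               ∎
    where
    open ≡-Reasoning
    l : List ℕ
    l = toℕs π
    |l| : length l ≡ n
    |l| = trans (length-map toℕ π) |π|≡n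
    k≤|l| : k ≤ length l
    k≤|l| = ≤-trans k≤n (≤-reflexive (sym |l|))

  module OddSlot {π : List (Fin n)} {k : ℕ} (p∈ : (π , k) ∈ slots n) (k-odd : parity k ≡ 1ℙ) where

    private
      π∈ : π ∈ perms n
      π∈ = proj₁ (∈-slots⁻ p∈)
      k≤n : k ≤ n
      k≤n = proj₂ (∈-slots⁻ p∈)
      |π| : length π ≡ n
      |π| = proj₁ (∈-perms⁻ π∈)
      Pre Post : List ℕ
      Pre = toℕs (take k π)
      Post = toℕs (drop k π)

      toℕs-π : toℕs π ≡ Pre ++ Post
      toℕs-π = trans (cong toℕs (sym (take++drop≡id k π))) (map-++ toℕ (take k π) (drop k π))

      toℕs-rotate : toℕs (rotate k π) ≡ Post ++ Pre
      toℕs-rotate = map-++ toℕ (drop k π) (take k π)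

      |Pre| : length Pre ≡ k
      |Pre| = trans (length-map toℕ (take k π)) (length-take-≤ π (≤-trans k≤n (≤-reflexive (sym |π|))))

      |Post| : length Post ≡ n ∸ k
      |Post| = trans (length-map toℕ (drop k π)) (trans (length-drop k π) (cong (_∸ k) |π|))

      |Pre|-odd : parity (length Pre) ≡ 1ℙ
      |Pre|-odd = trans (cong parity |Pre|) k-odd

      |Post|-odd : parity (length Post) ≡ 1ℙ
      |Post|-odd = trans (cong parity |Post|) (trans (parity-∸ n-even k≤n) k-odd)

    parity-inv-rotate : parity (inv (rotate k π)) ≡ parity (inv π) ℙ.+ 1ℙ
    parity-inv-rotate = begin
      parity (inv (rotate k π))                   ≡⟨ cong parity (trans (inv-toℕs (rotate k π)) (cong invN toℕs-rotate)) ⟩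
      parity (invN (Post ++ Pre))                      ≡⟨ parity-invN-swap Pre Post (Unique-++-disjoint TD!) ⟩
      parity (invN (Pre ++ Post)) ℙ.+ parity (length Pre * length Post)
        ≡⟨ cong₂ ℙ._+_ (cong (parity ∘ invN) (sym toℕs-π)) (ℙ.*-homo-* (length Pre) (length Post)) ⟩
      parity (invN (toℕs π)) ℙ.+ (parity (length Pre) ℙ.* parity (length Post))
        ≡⟨ cong₂ (λ i m → parity i ℙ.+ m) (sym (inv-toℕs π)) (cong₂ ℙ._*_ |Pre|-odd |Post|-odd) ⟩
      parity (inv π) ℙ.+ 1ℙ                       ∎
      where
      open ≡-Reasoning
      TD! : Unique (Pre ++ Post)
      TD! = subst Unique toℕs-π (Unique.map⁺ toℕ-injective (proj₂ (∈-perms⁻ π∈)))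

    des-insertMax-rotate : des (insertMax (rotate k π , n ∸ k)) ≡ des (insertMax (π , k))
    des-insertMax-rotate = begin
      des (insertMax (rotate k π , n ∸ k))   ≡⟨ des-insertMax (rotate k π) (n ∸ k) ⟩
      desN (insertAt (n ∸ k) n (toℕs (rotate k π)))
        ≡⟨ cong₂ (λ m xs → desN (insertAt m n xs)) (sym |Post|) toℕs-rotate ⟩
      desN (insertAt (length Post) n (Post ++ Pre))  ≡⟨ cong desN (insertAt-++ n Post Pre) ⟩
      desN (Post ++ n ∷ Pre)                      ≡⟨ desN-swap Post Pre Post<n Pre<n (odd⇒>0 |Post|-odd) (odd⇒>0 |Pre|-odd) ⟩
      desN (Pre ++ n ∷ Post)                      ≡⟨ cong desN (sym (insertAt-++ n Pre Post)) ⟩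
      desN (insertAt (length Pre) n (Pre ++ Post))  ≡⟨ cong₂ (λ m xs → desN (insertAt m n xs)) |Pre| (sym toℕs-π) ⟩
      desN (insertAt k n (toℕs π))           ≡⟨ sym (des-insertMax π k) ⟩
      des (insertMax (π , k))                ∎
      where
      open ≡-Reasoning
      TD<n : All (_< n) (Pre ++ Post)
      TD<n = subst (All (_< n)) toℕs-π (toℕs<n π)
      Pre<n : All (_< n) Pre
      Pre<n = ++⁻ˡ Pre TD<n
      Post<n : All (_< n) Post
      Post<n = ++⁻ʳ Pre TD<n

  weight-swapOddBlocks : ∀ W {π k} → (π , k) ∈ slots n →
    weight W (insertMax (swapOddBlocks n (π , k)))
    ≡ W (parity (inv π)) (asc (insertMax (π , k))) (des (insertMax (π , k)))
  weight-swapOddBlocks W {π} {k} p∈ with parity k in k-parity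
  ... | 0ℙ = cong (λ q → W q (asc (insertMax (π , k))) (des (insertMax (π , k))))
                  (trans (parity-inv-insertMax p∈) (trans (cong (parity (inv π) ℙ.+_) k-parity) (ℙ.+-identityʳ _)))
  ... | 1ℙ = cong₂ (λ q d → W q (n ∸ d) d) parity-preserved (OddSlot.des-insertMax-rotate p∈ k-parity)
    where
    open ≡-Reasoning
    k≤n : k ≤ n
    k≤n = proj₂ (∈-slots⁻ p∈)
    parity-preserved : parity (inv (insertMax (rotate k π , n ∸ k))) ≡ parity (inv π)
    parity-preserved = begin
      parity (inv (insertMax (rotate k π , n ∸ k)))  ≡⟨ parity-inv-insertMax (rotate-∈-slots p∈) ⟩
      parity (inv (rotate k π)) ℙ.+ parity (n ∸ k)
        ≡⟨ cong₂ ℙ._+_ (OddSlot.parity-inv-rotate p∈ k-parity) (trans (parity-∸ n-even k≤n) k-parity) ⟩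
      parity (inv π) ℙ.+ 1ℙ ℙ.+ 1ℙ                   ≡⟨ x+1+1≡x (parity (inv π)) ⟩
      parity (inv π)                                 ∎

signed-recurrence : ∀ n → parity (suc n) ≡ 0ℙ → (W : Parity → ℕ → ℕ → ℕ) →
  ∑ (perms (suc (suc n))) (weight W)
  ≡ ∑[ π ∈ perms (suc n) ] (suc (asc π) * W (parity (inv π)) (asc π) (suc (des π))
                           + suc (des π) * W (parity (inv π)) (suc (asc π)) (des π))
signed-recurrence n even W = begin
  ∑ (perms (suc N)) (weight W)
    ≡⟨ ∑-perms-suc N (weight W) ⟩
  ∑ (slots N) (weight W ∘ insertMax)
    ≡⟨ ∑-involution (swapOddBlocks N) (Unique-slots N)
                    (swapOddBlocks-∈ even) (swapOddBlocks-involutive even) (weight W ∘ insertMax) ⟩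
  ∑ (slots N) (weight W ∘ insertMax ∘ swapOddBlocks N)
    ≡⟨ ∑-cong (slots N) (λ {(π , k)} p∈ → weight-swapOddBlocks even W p∈) ⟩
  ∑ (slots N) (λ (π , k) → W (parity (inv π)) (asc (insertMax (π , k))) (des (insertMax (π , k))))
    ≡⟨ ∑-cartesianProduct (perms N) (upTo (suc N)) _ ⟩
  ∑[ π ∈ perms N ] ∑[ k ∈ upTo (suc N) ]
    W (parity (inv π)) (asc (insertMax (π , k))) (des (insertMax (π , k)))
    ≡⟨ ∑-cong (perms N) (λ {π} π∈ → insertMax-stats (W (parity (inv π))) π∈) ⟩
  ∑[ π ∈ perms N ] (suc (asc π) * W (parity (inv π)) (asc π) (suc (des π))
                   + suc (des π) * W (parity (inv π)) (suc (asc π)) (des π)) ∎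
  where
  open ≡-Reasoning
  N : ℕ
  N = suc n

eulerStep : Poly → Poly
eulerStep P = (s· P ⊕ t· P) ⊕ s· (t· (D P))

eulerStep-coeff : ∀ P i j → eulerStep P i j ≡ suc i * t· P i j + suc j * s· P i j
eulerStep-coeff P zero    zero    = refl
eulerStep-coeff P zero    (suc j) =
  solve 2 (λ j x → x :+ con 0 := con 1 :* x :+ (con 2 :+ j) :* con 0) refl j (P 0 j)
  where open +-*-Solver
eulerStep-coeff P (suc i) zero    =
  solve 2 (λ i x → x :+ con 0 :+ con 0 := (con 2 :+ i) :* con 0 :+ con 1 :* x) refl i (P i 0)
  where open +-*-Solver
eulerStep-coeff P (suc i) (suc j) =
  solve 4 (λ i j x y → y :+ x :+ ((con 1 :+ i) :* x :+ (con 1 :+ j) :* y)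
                     := (con 2 :+ i) :* x :+ (con 2 :+ j) :* y)
        refl i j (P (suc i) j) (P i (suc j))
  where open +-*-Solver

eulerStep-cong : ∀ {P Q} → P ≐ Q → eulerStep P ≐ eulerStep Q
eulerStep-cong {P} {Q} P≐Q i j =
  trans (eulerStep-coeff P i j)
        (trans (cong₂ (λ x y → suc i * x + suc j * y) (t·-cong j) (s·-cong i)) (sym (eulerStep-coeff Q i j)))
  where
  t·-cong : ∀ j → t· P i j ≡ t· Q i j
  t·-cong zero    = refl
  t·-cong (suc j) = P≐Q i j
  s·-cong : ∀ i → s· P i j ≡ s· Q i j
  s·-cong zero    = refl
  s·-cong (suc i) = P≐Q i j

indicator : Parity → ℕ → ℕ → Parity → ℕ → ℕ → ℕ
indicator p i j q a d = 𝟙 (does (q ℙ.≟ p) ∧ (a ≡ᵇ i) ∧ (d ≡ᵇ j))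

signedA : Parity → ℕ → Poly
signedA p n i j = ∑ (perms n) (weight (indicator p i j))

-- suc (suc m) % 2 reduces to m % 2
even?-parity : ∀ m → does (m % 2 ≟ 0) ≡ does (parity m ℙ.≟ 0ℙ)
even?-parity zero          = refl
even?-parity (suc zero)    = refl
even?-parity (suc (suc m)) = even?-parity m

odd?-parity : ∀ m → not (does (m % 2 ≟ 0)) ≡ does (parity m ℙ.≟ 1ℙ)
odd?-parity m rewrite even?-parity m with parity m
... | 0ℙ = refl
... | 1ℙ = refl

A⁺≐signedA : ∀ n → A⁺ n ≐ signedA 0ℙ n
A⁺≐signedA n i j = trans (length-filter _ (perms n))
  (∑-cong (perms n) λ {π} _ → cong (λ b → 𝟙 (b ∧ (asc π ≡ᵇ i) ∧ (des π ≡ᵇ j))) (even?-parity (inv π)))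

A⁻≐signedA : ∀ n → A⁻ n ≐ signedA 1ℙ n
A⁻≐signedA n i j = trans (length-filter _ (perms n))
  (∑-cong (perms n) λ {π} _ → cong (λ b → 𝟙 (b ∧ (asc π ≡ᵇ i) ∧ (des π ≡ᵇ j))) (odd?-parity (inv π)))

T-∧₃ : ∀ x y z → T (x ∧ y ∧ z) → T y × T z
T-∧₃ true true true _ = _ , _

*-𝟙-cong : ∀ {m n} b → (T b → m ≡ n) → m * 𝟙 b ≡ n * 𝟙 b
*-𝟙-cong         true  m≡n = cong (_* 1) (m≡n _)
*-𝟙-cong {m} {n} false _   = trans (*-zeroʳ m) (sym (*-zeroʳ n))

indicator-asc : ∀ p i j q a d → a * indicator p i j q a d ≡ i * indicator p i j q a d
indicator-asc p i j q a d =
  *-𝟙-cong (does (q ℙ.≟ p) ∧ (a ≡ᵇ i) ∧ (d ≡ᵇ j)) (≡ᵇ⇒≡ a i ∘ proj₁ ∘ T-∧₃ (does (q ℙ.≟ p)) (a ≡ᵇ i) (d ≡ᵇ j))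

indicator-des : ∀ p i j q a d → d * indicator p i j q a d ≡ j * indicator p i j q a d
indicator-des p i j q a d =
  *-𝟙-cong (does (q ℙ.≟ p) ∧ (a ≡ᵇ i) ∧ (d ≡ᵇ j)) (≡ᵇ⇒≡ d j ∘ proj₂ ∘ T-∧₃ (does (q ℙ.≟ p)) (a ≡ᵇ i) (d ≡ᵇ j))

t·-signedA : ∀ p n i j →
  ∑[ π ∈ perms n ] indicator p i j (parity (inv π)) (asc π) (suc (des π)) ≡ t· (signedA p n) i j
t·-signedA p n i zero    = ∑-zero (perms n) λ {π} _ →
  cong 𝟙 (trans (cong (does (parity (inv π) ℙ.≟ p) ∧_) (∧-zeroʳ (asc π ≡ᵇ i))) (∧-zeroʳ _))
t·-signedA p n i (suc j) = refl

s·-signedA : ∀ p n i j →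
  ∑[ π ∈ perms n ] indicator p i j (parity (inv π)) (suc (asc π)) (des π) ≡ s· (signedA p n) i j
s·-signedA p n zero    j = ∑-zero (perms n) λ {π} _ → cong 𝟙 (∧-zeroʳ (does (parity (inv π) ℙ.≟ p)))
s·-signedA p n (suc i) j = refl

signedA-recurrence : ∀ p n → parity (suc n) ≡ 0ℙ → signedA p (suc (suc n)) ≐ eulerStep (signedA p (suc n))
signedA-recurrence p n even i j = begin
  ∑ (perms (suc (suc n))) (weight (indicator p i j))
    ≡⟨ signed-recurrence n even (indicator p i j) ⟩
  ∑[ π ∈ Sₙ ] (suc (asc π) * W π (asc π) (suc (des π)) + suc (des π) * W π (suc (asc π)) (des π))
    ≡⟨ ∑-cong Sₙ (λ {π} _ → cong₂ _+_
         (cong (W π (asc π) (suc (des π)) +_) (indicator-asc p i j (parity (inv π)) (asc π) (suc (des π))))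
         (cong (W π (suc (asc π)) (des π) +_) (indicator-des p i j (parity (inv π)) (suc (asc π)) (des π)))) ⟩
  ∑[ π ∈ Sₙ ] (suc i * W π (asc π) (suc (des π)) + suc j * W π (suc (asc π)) (des π))
    ≡⟨ trans (∑-+ Sₙ _ _) (cong₂ _+_ (∑-*ˡ Sₙ (suc i) _) (∑-*ˡ Sₙ (suc j) _)) ⟩
  suc i * ∑[ π ∈ Sₙ ] W π (asc π) (suc (des π)) + suc j * ∑[ π ∈ Sₙ ] W π (suc (asc π)) (des π)
    ≡⟨ cong₂ (λ x y → suc i * x + suc j * y) (t·-signedA p (suc n) i j) (s·-signedA p (suc n) i j) ⟩
  suc i * t· (signedA p (suc n)) i j + suc j * s· (signedA p (suc n)) i j
    ≡⟨ sym (eulerStep-coeff (signedA p (suc n)) i j) ⟩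
  eulerStep (signedA p (suc n)) i j ∎
  where
  open ≡-Reasoning
  Sₙ : List (List (Fin (suc n)))
  Sₙ = perms (suc n)
  W : List (Fin (suc n)) → ℕ → ℕ → ℕ
  W π = indicator p i j (parity (inv π))

theorem15 : (m : ℕ) → 1 ≤ m →
    (A⁺ (2 * m + 1) ≐ (s· (A⁺ (2 * m)) ⊕ t· (A⁺ (2 * m))) ⊕ s· (t· (D (A⁺ (2 * m)))))
    × (A⁻ (2 * m + 1) ≐ (s· (A⁻ (2 * m)) ⊕ t· (A⁻ (2 * m))) ⊕ s· (t· (D (A⁻ (2 * m)))))
theorem15 m@(suc _) _ = recurrence 0ℙ A⁺≐signedA , recurrence 1ℙ A⁻≐signedA
  where
  recurrence : ∀ {A : ℕ → Poly} p → (∀ n → A n ≐ signedA p n) → A (2 * m + 1) ≐ eulerStep (A (2 * m))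
  recurrence {A} p A≐ i j = begin
    A (2 * m + 1) i j                 ≡⟨ cong (λ k → A k i j) (+-comm (2 * m) 1) ⟩
    A (suc (2 * m)) i j               ≡⟨ A≐ (suc (2 * m)) i j ⟩
    signedA p (suc (2 * m)) i j       ≡⟨ signedA-recurrence p (pred (2 * m)) (ℙ.*-homo-* 2 m) i j ⟩
    eulerStep (signedA p (2 * m)) i j ≡⟨ eulerStep-cong (λ a d → sym (A≐ (2 * m) a d)) i j ⟩
    eulerStep (A (2 * m)) i j         ∎
    where open ≡-Reasoning
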